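{- Let $w$ be a permutation and suppose that $I \in \mathcal{P}(w)$ covers exactly the elements $H_1, \ldots, H_k$ of $\mathcal{P}(w)$, where $k \ge 4$. Then for each $i$, $I$ is the only element of $\mathcal{P}(w)$ that covers $H_i$.
   Context: For $w \in \mathfrak{S}_n$ in one-line notation $w(1)\cdots w(n)$, an interval of $w$ is a set of consecutive integers $[h,h+j]$ with $\{w(t) : t \in [i,i+j]\} = [h,h+j]$ for some $i$. The interval poset $\mathcal{P}(w)$ is the set of nonempty intervals of $w$ ordered by inclusion. -}

module Defs where

open import Data.Nat using (ℕ; _+_; _≤_; _<_)
open import Data.Fin using (Fin; toℕ)
open import Data.Product using (Σ; ∃; _×_; _,_)
open import Relation.Binary.PropositionalEquality using (_≡_)
open import Relation.Nullary using (¬_)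
open import Function.Definitions using (Injective)

-- A permutation of an n-element set, in one-line notation w(0)…w(n-1)
-- (0-indexed positions and values; an injective self-map of Fin n).
Perm : ℕ → Set
Perm n = Σ (Fin n → Fin n) (Injective _≡_ _≡_)

-- The set of consecutive integers [h, h+j]  (always nonempty).
record Seg : Set where
  constructor [_,+_]
  field
    h : ℕ
    j : ℕ
open Seg public

_∈Seg_ : ℕ → Seg → Set
x ∈Seg S = h S ≤ x × x ≤ h S + j S

IsInterval : ∀ {n} → Perm n → Seg → Set
IsInterval {n} (w , _) S =
  ∃ λ (i : ℕ) → (i + j S < n) ×
    ( (∀ (t : Fin n) → toℕ t ∈Seg [ i ,+ j S ] → toℕ (w t) ∈Seg S)
    × (∀ (v : ℕ) → v ∈Seg S → ∃ λ (t : Fin n) → toℕ t ∈Seg [ i ,+ j S ] × toℕ (w t) ≡ v) )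

_⊆_ : Seg → Seg → Set
S ⊆ T = ∀ (x : ℕ) → x ∈Seg S → x ∈Seg T

_⊂_ : Seg → Seg → Set
S ⊂ T = S ⊆ T × ¬ (T ⊆ S)

Covers : ∀ {n} → Perm n → Seg → Seg → Set
Covers w I H =
  IsInterval w I × IsInterval w H × H ⊂ I ×
  (∀ J → IsInterval w J → H ⊂ J → ¬ (J ⊂ I))

-- If I and some J ≠ I both cover Hᵢ, then I and J overlap without being nested, so
-- I ∩ J and I ∖ J are intervals and I splits into two adjacent intervals. Every element
-- covered by a split interval I must then share an endpoint with I (otherwise it would sit
-- strictly inside one half, or its union with the left half would lie strictly between it
-- and I), and two such elements sharing the same endpoint are nested, hence equal. So a
-- split interval covers at most two elements, contradicting k ≥ 3.
module Submission where

open import Defs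
open import Data.Nat
open import Data.Nat.Properties
open import Data.Fin using (Fin; toℕ; fromℕ<) renaming (zero to 0F; suc to sucF)
open import Data.Fin.Properties
  using (toℕ-injective; toℕ<n; toℕ-fromℕ<; fromℕ<-injective; injective⇒≤; pigeonhole)
  renaming (<⇒≢ to <⇒≢ᶠ)
open import Data.Product using (Σ; ∃; _×_; _,_; proj₁; proj₂; map₂)
open import Data.Product.Function.NonDependent.Propositional using (_×-⇔_)
open import Data.Sum using (_⊎_; inj₁; inj₂; [_,_]′)
open import Data.Sum.Function.Propositional using (_⊎-⇔_)
open import Data.Empty using (⊥; ⊥-elim)
open import Function using (_∘_; id; const; case_of_)
open import Function.Bundles using (_⇔_; mk⇔; Equivalence)
open import Function.Definitions using (Injective)
open import Function.Properties.Equivalence using () renaming (trans to ⇔-trans; sym to ⇔-sym)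
open import Function.Related.TypeIsomorphisms using (¬-cong-⇔)
open import Relation.Nullary using (¬_; Dec; yes; no)
open import Relation.Nullary.Decidable using (_×-dec_) renaming (map to map-dec)
open import Relation.Binary.PropositionalEquality

open Equivalence using (to; from)

private variable
  a b v x : ℕ
  S T X Y Z : Seg

e : Seg → ℕ
e S = h S + j S

[_⋯_] : ℕ → ℕ → Seg
[ a ⋯ b ] = [ a ,+ b ∸ a ]

e-⋯ : a ≤ b → e [ a ⋯ b ] ≡ b
e-⋯ = m+[n∸m]≡n

h∈ : ∀ S → h S ∈Seg S
h∈ S = ≤-refl , m≤m+n (h S) (j S)

e∈ : ∀ S → e S ∈Seg S
e∈ S = m≤m+n (h S) (j S) , ≤-refl

<h⇒∉ : x < h S → ¬ x ∈Seg S
<h⇒∉ x<h (h≤x , _) = <⇒≱ x<h h≤x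

e<⇒∉ : e S < x → ¬ x ∈Seg S
e<⇒∉ e<x (_ , x≤e) = <⇒≱ e<x x≤e

∉∧h≤⇒e< : h S ≤ x → ¬ x ∈Seg S → e S < x
∉∧h≤⇒e< h≤x x∉S = ≰⇒> (λ x≤e → x∉S (h≤x , x≤e))

∉∧≤e⇒<h : x ≤ e S → ¬ x ∈Seg S → x < h S
∉∧≤e⇒<h x≤e x∉S = ≰⇒> (λ h≤x → x∉S (h≤x , x≤e))

⊆⇔ : S ⊆ T ⇔ (h T ≤ h S × e S ≤ e T)
⊆⇔ {S} = mk⇔ (λ S⊆T → proj₁ (S⊆T _ (h∈ S)) , proj₂ (S⊆T _ (e∈ S)))
              (λ (hT≤hS , eS≤eT) _ (hS≤x , x≤eS) → ≤-trans hT≤hS hS≤x , ≤-trans x≤eS eS≤eT)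

_⊆?_ : ∀ S T → Dec (S ⊆ T)
S ⊆? T = map-dec (⇔-sym ⊆⇔) ((h T ≤? h S) ×-dec (e S ≤? e T))

⊆-antisym : S ⊆ T → T ⊆ S → S ≡ T
⊆-antisym {[ a ,+ i ]} {[ b ,+ k ]} S⊆T T⊆S =
  cong₂ [_,+_] a≡b (+-cancelˡ-≡ a i k (trans (≤-antisym eS≤eT eT≤eS) (cong (_+ k) (sym a≡b))))
  where
  a≡b = ≤-antisym (proj₁ (to ⊆⇔ T⊆S)) (proj₁ (to ⊆⇔ S⊆T))
  eS≤eT = proj₂ (to ⊆⇔ S⊆T)
  eT≤eS = proj₂ (to ⊆⇔ T⊆S)

⊆∧¬⊂⇒≡ : S ⊆ T → ¬ S ⊂ T → S ≡ T
⊆∧¬⊂⇒≡ {S} {T} S⊆T S⊄T with T ⊆? S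
... | yes T⊆S = ⊆-antisym S⊆T T⊆S
... | no T⊈S = ⊥-elim (S⊄T (S⊆T , T⊈S))

h<⇒⊂ : h T < h S → e S ≤ e T → S ⊂ T
h<⇒⊂ hT<hS eS≤eT = from ⊆⇔ (<⇒≤ hT<hS , eS≤eT) , λ T⊆S → <⇒≱ hT<hS (proj₁ (to ⊆⇔ T⊆S))

e<⇒⊂ : h T ≤ h S → e S < e T → S ⊂ T
e<⇒⊂ hT≤hS eS<eT = from ⊆⇔ (hT≤hS , <⇒≤ eS<eT) , λ T⊆S → <⇒≱ eS<eT (proj₂ (to ⊆⇔ T⊆S))

_Represents_ : Seg → (ℕ → Set) → Set
Z Represents P = ∀ x → x ∈Seg Z ⇔ P x

⋯-represents : {P : ℕ → Set} → a ≤ b → (∀ x → (a ≤ x × x ≤ b) ⇔ P x) → [ a ⋯ b ] Represents P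
⋯-represents a≤b rep x = ⇔-trans (mk⇔ (map₂ (subst (x ≤_) e≡b)) (map₂ (subst (x ≤_) (sym e≡b)))) (rep x)
  where e≡b = e-⋯ a≤b

∩-segment : x ∈Seg X → x ∈Seg Y → Σ Seg (_Represents λ v → v ∈Seg X × v ∈Seg Y)
∩-segment {X = X} {Y} (hX≤x , x≤eX) (hY≤x , x≤eY) =
  [ h X ⊔ h Y ⋯ e X ⊓ e Y ] , ⋯-represents (≤-trans (⊔-lub hX≤x hY≤x) (⊓-glb x≤eX x≤eY)) λ _ → mk⇔
    (λ (h≤v , v≤e) → (m⊔n≤o⇒m≤o _ _ h≤v , m≤n⊓o⇒m≤n _ _ v≤e)
                   , (m⊔n≤o⇒n≤o _ _ h≤v , m≤n⊓o⇒m≤o _ _ v≤e))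
    (λ ((hX≤v , v≤eX) , (hY≤v , v≤eY)) → ⊔-lub hX≤v hY≤v , ⊓-glb v≤eX v≤eY)

∪-segment : x ∈Seg X → x ∈Seg Y → Σ Seg (_Represents λ v → v ∈Seg X ⊎ v ∈Seg Y)
∪-segment {x} {X} {Y} (hX≤x , x≤eX) (hY≤x , x≤eY) =
  [ h X ⊓ h Y ⋯ e X ⊔ e Y ] , ⋯-represents (≤-trans (m⊓n≤m _ _) (≤-trans hX≤x (≤-trans x≤eX (m≤m⊔n _ _))))
    λ _ → mk⇔ split
      [ (λ (hX≤v , v≤eX) → ≤-trans (m⊓n≤m _ _) hX≤v , ≤-trans v≤eX (m≤m⊔n _ _))
      , (λ (hY≤v , v≤eY) → ≤-trans (m⊓n≤n _ _) hY≤v , ≤-trans v≤eY (m≤n⊔m _ _)) ]′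
  where
  -- a point left of x lies in whichever segment starts first, a point right of x in whichever ends last
  split : h X ⊓ h Y ≤ v × v ≤ e X ⊔ e Y → v ∈Seg X ⊎ v ∈Seg Y
  split {v} (h≤v , v≤e) with v ≤? x
  ... | yes v≤x = [ (λ h≡hX → inj₁ (subst (_≤ v) h≡hX h≤v , ≤-trans v≤x x≤eX))
                  , (λ h≡hY → inj₂ (subst (_≤ v) h≡hY h≤v , ≤-trans v≤x x≤eY)) ]′ (⊓-sel (h X) (h Y))
  ... | no v≰x = [ (λ e≡eX → inj₁ (≤-trans hX≤x x≤v , subst (v ≤_) e≡eX v≤e))
                 , (λ e≡eY → inj₂ (≤-trans hY≤x x≤v , subst (v ≤_) e≡eY v≤e)) ]′ (⊔-sel (e X) (e Y))
    where x≤v = <⇒≤ (≰⇒> v≰x)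

∖-segment : x ∈Seg X → x ∈Seg Y → a ∈Seg X → ¬ a ∈Seg Y → b ∈Seg Y → ¬ b ∈Seg X →
  Σ Seg (_Represents λ v → v ∈Seg X × ¬ v ∈Seg Y)
∖-segment {x} {X} {Y} {a} {b} (hX≤x , x≤eX) (hY≤x , x≤eY) (hX≤a , a≤eX) a∉Y (hY≤b , b≤eY) b∉X
  with h X ≤? b
-- b tells on which side Y sticks out of X
... | no hX≰b = [ suc (e Y) ⋯ e X ] , ⋯-represents (≤-trans eY<a a≤eX) λ _ → mk⇔
      (λ (eY<v , v≤eX) → (≤-trans hX≤x (≤-trans x≤eY (<⇒≤ eY<v)) , v≤eX) , e<⇒∉ eY<v)
      (λ ((hX≤v , v≤eX) , v∉Y) → ∉∧h≤⇒e< (hY≤X hX≤v) v∉Y , v≤eX)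
  where
  hY≤X : h X ≤ v → h Y ≤ v
  hY≤X hX≤v = ≤-trans hY≤b (≤-trans (<⇒≤ (≰⇒> hX≰b)) hX≤v)
  eY<a = ∉∧h≤⇒e< (hY≤X hX≤a) a∉Y
... | yes hX≤b = [ h X ⋯ pred (h Y) ] , ⋯-represents (<⇒≤pred (≤-<-trans hX≤a a<hY)) λ _ → mk⇔
      (λ (hX≤v , v≤p) → let v<hY = m≤pred[n]⇒suc[m]≤n {{>-nonZero (≤-<-trans z≤n a<hY)}} v≤p in
                        (hX≤v , ≤-trans (<⇒≤ v<hY) (≤-trans hY≤x x≤eX)) , <h⇒∉ v<hY)
      (λ ((hX≤v , v≤eX) , v∉Y) → hX≤v , <⇒≤pred (∉∧≤e⇒<h (≤eY v≤eX) v∉Y))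
  where
  eX<b = ∉∧h≤⇒e< hX≤b b∉X
  ≤eY : v ≤ e X → v ≤ e Y
  ≤eY v≤eX = ≤-trans v≤eX (≤-trans (<⇒≤ eX<b) b≤eY)
  a<hY = ∉∧≤e⇒<h (≤eY a≤eX) a∉Y

injection⇒j≤j : (g : ∀ x → x ∈Seg X → ℕ) → (∀ x p → g x p ∈Seg Y) →
  (∀ {x y} p q → g x p ≡ g y q → x ≡ y) → j X ≤ j Y
injection⇒j≤j {X} {Y} g g∈Y g-inj = s≤s⁻¹ (injective⇒≤ F-inj)
  where
  point : (i : Fin (suc (j X))) → (h X + toℕ i) ∈Seg X
  point i = m≤m+n _ _ , +-monoʳ-≤ (h X) (s≤s⁻¹ (toℕ<n i))
  F : Fin (suc (j X)) → Fin (suc (j Y))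
  F i = fromℕ< (s≤s (m≤n+o⇒m∸n≤o _ (h Y) (proj₂ (g∈Y _ (point i)))))
  F-inj : Injective _≡_ _≡_ F
  F-inj {i} {i′} Fi≡Fi′ = toℕ-injective (+-cancelˡ-≡ (h X) _ _ (g-inj (point i) (point i′)
    (∸-cancelʳ-≡ (proj₁ (g∈Y _ (point i))) (proj₁ (g∈Y _ (point i′))) (fromℕ<-injective _ _ _ _ Fi≡Fi′))))

-- Membership in the block of positions of an interval is equivalent to membership of the value
-- in the interval, so it commutes with any pointwise connective; a combination of two
-- intervals is therefore an interval as soon as the combined block of positions is a segment.
record Connective : Set₁ where
  field
    _⊙_ : Set → Set → Set
    ⊙-cong : ∀ {A A′ B B′} → A ⇔ A′ → B ⇔ B′ → (A ⊙ B) ⇔ (A′ ⊙ B′)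
    ⊙⇒⊎ : ∀ {A B} → A ⊙ B → A ⊎ B

  _⟨⊙⟩_ : Seg → Seg → ℕ → Set
  (X ⟨⊙⟩ Y) v = (v ∈Seg X) ⊙ (v ∈Seg Y)

∧-connective : Connective
∧-connective = record { _⊙_ = _×_ ; ⊙-cong = _×-⇔_ ; ⊙⇒⊎ = inj₁ ∘ proj₁ }

∨-connective : Connective
∨-connective = record { _⊙_ = _⊎_ ; ⊙-cong = _⊎-⇔_ ; ⊙⇒⊎ = id }

∖-connective : Connective
∖-connective = record
  { _⊙_ = λ A B → A × ¬ B
  ; ⊙-cong = λ A⇔A′ B⇔B′ → A⇔A′ ×-⇔ ¬-cong-⇔ B⇔B′
  ; ⊙⇒⊎ = inj₁ ∘ proj₁
  }

module _ {n : ℕ} (f : Fin n → Fin n) (f-inj : Injective _≡_ _≡_ f) where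

  w : Perm n
  w = f , f-inj

  -- IsInterval without the condition that the blocks of positions and values have equal
  -- length; that condition follows by counting (window⇒interval).
  record Window (S : Seg) : Set where
    field
      positions : Seg
      positions-bounded : e positions < n
      preimage : ∀ t → toℕ t ∈Seg positions ⇔ toℕ (f t) ∈Seg S
      onto : ∀ v → v ∈Seg S → ∃ λ t → toℕ (f t) ≡ v

  interval⇒window : IsInterval w S → Window S
  interval⇒window {S} (i , bounded , into , onto) = record
    { positions = [ i ,+ j S ]
    ; positions-bounded = bounded
    ; preimage = λ t → mk⇔ (into t) λ ft∈S → let (t′ , t′∈ , ft′≡ft) = onto _ ft∈S in
        subst (λ u → toℕ u ∈Seg [ i ,+ j S ]) (f-inj (toℕ-injective ft′≡ft)) t′∈
    ; onto = λ v v∈S → map₂ proj₂ (onto v v∈S)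
    }

  window⇒interval : Window S → IsInterval w S
  window⇒interval {S} W =
    h P , subst (λ k → h P + k < n) jP≡jS positions-bounded ,
    (λ t t∈ → to (preimage t) (subst (λ k → toℕ t ∈Seg [ h P ,+ k ]) (sym jP≡jS) t∈)) ,
    λ v v∈S → let (t , ft≡v) = onto v v∈S in
      t , subst (λ k → toℕ t ∈Seg [ h P ,+ k ]) jP≡jS (from (preimage t) (subst (_∈Seg S) (sym ft≡v) v∈S)) , ft≡v
    where
    open Window W
    P = positions
    at : ∀ t → t ∈Seg P → Fin n
    at t t∈P = fromℕ< (≤-<-trans (proj₂ t∈P) positions-bounded)
    jP≤jS : j P ≤ j S
    jP≤jS = injection⇒j≤j (λ t t∈P → toℕ (f (at t t∈P)))
      (λ t t∈P → to (preimage _) (subst (_∈Seg P) (sym (toℕ-fromℕ< _)) t∈P))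
      (λ p q eq → fromℕ<-injective _ _ _ _ (f-inj (toℕ-injective eq)))
    jS≤jP : j S ≤ j P
    jS≤jP = injection⇒j≤j (λ v v∈S → toℕ (proj₁ (onto v v∈S)))
      (λ v v∈S → let (t , ft≡v) = onto v v∈S in from (preimage t) (subst (_∈Seg S) (sym ft≡v) v∈S))
      (λ {v} {v′} p q eq → trans (sym (proj₂ (onto v p)))
                              (trans (cong (toℕ ∘ f) (toℕ-injective eq)) (proj₂ (onto v′ q))))
    jP≡jS : j P ≡ j S
    jP≡jS = ≤-antisym jP≤jS jS≤jP

  module _ (C : Connective) {S₁ S₂ : Seg} (W₁ : Window S₁) (W₂ : Window S₂) where
    open Connective C
    open Window

    preimage-⊙ : ∀ t → (positions W₁ ⟨⊙⟩ positions W₂) (toℕ t) ⇔ (S₁ ⟨⊙⟩ S₂) (toℕ (f t))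
    preimage-⊙ t = ⊙-cong (preimage W₁ t) (preimage W₂ t)

    onto-⊙ : (S₁ ⟨⊙⟩ S₂) v → ∃ λ t → toℕ (f t) ≡ v
    onto-⊙ {v} = [ onto W₁ v , onto W₂ v ]′ ∘ ⊙⇒⊎

    window-witness : (S₁ ⟨⊙⟩ S₂) v → ∃ λ t → (positions W₁ ⟨⊙⟩ positions W₂) (toℕ t)
    window-witness {v} v∈ = let (t , ft≡v) = onto-⊙ v∈ in
      t , from (preimage-⊙ t) (subst (S₁ ⟨⊙⟩ S₂) (sym ft≡v) v∈)

    combine-windows : Z Represents (S₁ ⟨⊙⟩ S₂) →
      (Q : Seg) → Q Represents (positions W₁ ⟨⊙⟩ positions W₂) → Window Z
    combine-windows {Z} Z-rep Q Q-rep = record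
      { positions = Q
      ; positions-bounded = [ bounded W₁ , bounded W₂ ]′ (⊙⇒⊎ (to (Q-rep (e Q)) (e∈ Q)))
      ; preimage = λ t → ⇔-trans (Q-rep (toℕ t)) (⇔-trans (preimage-⊙ t) (⇔-sym (Z-rep (toℕ (f t)))))
      ; onto = λ v → onto-⊙ ∘ to (Z-rep v)
      }
      where
      bounded : ∀ {S} (W : Window S) → e Q ∈Seg positions W → e Q < n
      bounded W (_ , eQ≤e) = ≤-<-trans eQ≤e (positions-bounded W)

  module _ {S₁ S₂ : Seg} (I₁ : IsInterval w S₁) (I₂ : IsInterval w S₂) where
    private
      W₁ = interval⇒window I₁
      W₂ = interval⇒window I₂

    ∩-interval : x ∈Seg S₁ → x ∈Seg S₂ → Z Represents (λ v → v ∈Seg S₁ × v ∈Seg S₂) → IsInterval w Z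
    ∩-interval x∈S₁ x∈S₂ Z-rep =
      let (_ , t∈P₁ , t∈P₂) = window-witness ∧-connective W₁ W₂ (x∈S₁ , x∈S₂)
          (Q , Q-rep) = ∩-segment t∈P₁ t∈P₂
      in window⇒interval (combine-windows ∧-connective W₁ W₂ Z-rep Q Q-rep)

    ∪-interval : x ∈Seg S₁ → x ∈Seg S₂ → Z Represents (λ v → v ∈Seg S₁ ⊎ v ∈Seg S₂) → IsInterval w Z
    ∪-interval x∈S₁ x∈S₂ Z-rep =
      let (_ , t∈P₁ , t∈P₂) = window-witness ∧-connective W₁ W₂ (x∈S₁ , x∈S₂)
          (Q , Q-rep) = ∪-segment t∈P₁ t∈P₂
      in window⇒interval (combine-windows ∨-connective W₁ W₂ Z-rep Q Q-rep)

    ∖-interval : x ∈Seg S₁ → x ∈Seg S₂ → a ∈Seg S₁ → ¬ a ∈Seg S₂ → b ∈Seg S₂ → ¬ b ∈Seg S₁ →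
      Z Represents (λ v → v ∈Seg S₁ × ¬ v ∈Seg S₂) → IsInterval w Z
    ∖-interval x∈S₁ x∈S₂ a∈S₁ a∉S₂ b∈S₂ b∉S₁ Z-rep =
      let (_ , t∈P₁ , t∈P₂) = window-witness ∧-connective W₁ W₂ (x∈S₁ , x∈S₂)
          (_ , r∈P₁ , r∉P₂) = window-witness ∖-connective W₁ W₂ (a∈S₁ , a∉S₂)
          (_ , s∈P₂ , s∉P₁) = window-witness ∖-connective W₂ W₁ (b∈S₂ , b∉S₁)
          (Q , Q-rep) = ∖-segment t∈P₁ t∈P₂ r∈P₁ r∉P₂ s∈P₂ s∉P₁
      in window⇒interval (combine-windows ∖-connective W₁ W₂ Z-rep Q Q-rep)

  record Split (I : Seg) : Set where
    field
      left right : Seg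
      left-interval : IsInterval w left
      right-interval : IsInterval w right
      h-left : h left ≡ h I
      adjacent : suc (e left) ≡ h right
      e-right : e right ≡ e I

  left-overhang⇒split : ∀ {I J} → IsInterval w I → IsInterval w J → x ∈Seg I → x ∈Seg J →
    h J < h I → e J < e I → Split I
  left-overhang⇒split {I = I} {J} I-int J-int x∈I@(hI≤x , _) x∈J@(_ , x≤eJ) hJ<hI eJ<eI = record
    { left = [ h I ⋯ e J ]
    ; right = [ suc (e J) ⋯ e I ]
    ; left-interval = ∩-interval I-int J-int x∈I x∈J (⋯-represents hI≤eJ λ _ → mk⇔
        (λ (hI≤v , v≤eJ) → (hI≤v , ≤-trans v≤eJ (<⇒≤ eJ<eI)) , (≤-trans (<⇒≤ hJ<hI) hI≤v , v≤eJ))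
        (λ ((hI≤v , _) , (_ , v≤eJ)) → hI≤v , v≤eJ))
    ; right-interval = ∖-interval I-int J-int x∈I x∈J (e∈ I) (e<⇒∉ eJ<eI) (h∈ J) (<h⇒∉ hJ<hI)
        (⋯-represents eJ<eI λ _ → mk⇔
          (λ (eJ<v , v≤eI) → (≤-trans hI≤eJ (<⇒≤ eJ<v) , v≤eI) , e<⇒∉ eJ<v)
          (λ ((hI≤v , v≤eI) , v∉J) → ∉∧h≤⇒e< (≤-trans (<⇒≤ hJ<hI) hI≤v) v∉J , v≤eI))
    ; h-left = refl
    ; adjacent = cong suc (e-⋯ hI≤eJ)
    ; e-right = e-⋯ eJ<eI
    }
    where hI≤eJ = ≤-trans hI≤x x≤eJ

  right-overhang⇒split : ∀ {I J} → IsInterval w I → IsInterval w J → x ∈Seg I → x ∈Seg J →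
    h I < h J → e I < e J → Split I
  right-overhang⇒split {I = I} {J} I-int J-int x∈I@(_ , x≤eI) x∈J@(hJ≤x , _) hI<hJ eI<eJ = record
    { left = [ h I ⋯ pred (h J) ]
    ; right = [ h J ⋯ e I ]
    ; left-interval = ∖-interval I-int J-int x∈I x∈J (h∈ I) (<h⇒∉ hI<hJ) (e∈ J) (e<⇒∉ eI<eJ)
        (⋯-represents (<⇒≤pred hI<hJ) λ _ → mk⇔
          (λ (hI≤v , v≤p) → let v<hJ = m≤pred[n]⇒suc[m]≤n {{hJ≢0}} v≤p in
                            (hI≤v , ≤-trans (<⇒≤ v<hJ) hJ≤eI) , <h⇒∉ v<hJ)
          (λ ((hI≤v , v≤eI) , v∉J) → hI≤v , <⇒≤pred (∉∧≤e⇒<h (≤-trans v≤eI (<⇒≤ eI<eJ)) v∉J)))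
    ; right-interval = ∩-interval I-int J-int x∈I x∈J (⋯-represents hJ≤eI λ _ → mk⇔
        (λ (hJ≤v , v≤eI) → (≤-trans (<⇒≤ hI<hJ) hJ≤v , v≤eI) , (hJ≤v , ≤-trans v≤eI (<⇒≤ eI<eJ)))
        (λ ((_ , v≤eI) , (hJ≤v , _)) → hJ≤v , v≤eI))
    ; h-left = refl
    ; adjacent = trans (cong suc (e-⋯ (<⇒≤pred hI<hJ))) (suc-pred (h J) {{hJ≢0}})
    ; e-right = e-⋯ hJ≤eI
    }
    where
    hJ≤eI = ≤-trans hJ≤x x≤eI
    hJ≢0 = >-nonZero (≤-<-trans z≤n hI<hJ)

  overlap⇒split : ∀ {I J} → IsInterval w I → IsInterval w J → x ∈Seg I → x ∈Seg J →
    ¬ J ⊆ I → ¬ I ⊆ J → Split I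
  overlap⇒split {I = I} {J} I-int J-int x∈I x∈J J⊈I I⊈J with h J <? h I
  ... | yes hJ<hI = left-overhang⇒split I-int J-int x∈I x∈J hJ<hI
        (≰⇒> λ eI≤eJ → I⊈J (from ⊆⇔ (<⇒≤ hJ<hI , eI≤eJ)))
  ... | no hJ≮hI = right-overhang⇒split I-int J-int x∈I x∈J
        (≤∧≢⇒< hI≤hJ λ hI≡hJ → I⊈J (from ⊆⇔ (≤-reflexive (sym hI≡hJ) , <⇒≤ eI<eJ))) eI<eJ
    where
    hI≤hJ = ≮⇒≥ hJ≮hI
    eI<eJ = ≰⇒> λ eJ≤eI → J⊈I (from ⊆⇔ (hI≤hJ , eJ≤eI))

  covers⇒⊆ : ∀ {I K} → Covers w I K → K ⊆ I
  covers⇒⊆ (_ , _ , (K⊆I , _) , _) = K⊆I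

  covering-⊆⇒≡ : ∀ {I J K} → Covers w I K → Covers w J K → J ⊆ I → J ≡ I
  covering-⊆⇒≡ (_ , _ , _ , nothing-between) (J-int , _ , K⊂J , _) J⊆I =
    ⊆∧¬⊂⇒≡ J⊆I (nothing-between _ J-int K⊂J)

  covered-⊆⇒≡ : ∀ {I K K′} → Covers w I K → Covers w I K′ → K ⊆ K′ → K ≡ K′
  covered-⊆⇒≡ (_ , _ , _ , nothing-between) (_ , K′-int , K′⊂I , _) K⊆K′ =
    ⊆∧¬⊂⇒≡ K⊆K′ λ K⊂K′ → nothing-between _ K′-int K⊂K′ K′⊂I

  covered-h≡⇒≡ : ∀ {I K K′} → Covers w I K → Covers w I K′ → h K ≡ h K′ → K ≡ K′
  covered-h≡⇒≡ {K = K} {K′} c c′ hK≡hK′ with ≤-total (e K) (e K′)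
  ... | inj₁ eK≤eK′ = covered-⊆⇒≡ c c′ (from ⊆⇔ (≤-reflexive (sym hK≡hK′) , eK≤eK′))
  ... | inj₂ eK′≤eK = sym (covered-⊆⇒≡ c′ c (from ⊆⇔ (≤-reflexive hK≡hK′ , eK′≤eK)))

  covered-e≡⇒≡ : ∀ {I K K′} → Covers w I K → Covers w I K′ → e K ≡ e K′ → K ≡ K′
  covered-e≡⇒≡ {K = K} {K′} c c′ eK≡eK′ with ≤-total (h K) (h K′)
  ... | inj₁ hK≤hK′ = sym (covered-⊆⇒≡ c′ c (from ⊆⇔ (hK≤hK′ , ≤-reflexive (sym eK≡eK′))))
  ... | inj₂ hK′≤hK = covered-⊆⇒≡ c c′ (from ⊆⇔ (hK′≤hK , ≤-reflexive eK≡eK′))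

  split⇒no-inner-cover : ∀ {I K} → Split I → Covers w I K → h I < h K → e K < e I → ⊥
  split⇒no-inner-cover {I} {K} s (_ , K-int , _ , nothing-between) hI<hK eK<eI =
    by-position (e K ≤? e left) (h K ≤? e left)
    where
    open Split s
    eA<eI : e left < e I
    eA<eI = subst₂ _≤_ (sym adjacent) e-right (proj₂ (h∈ right))
    by-position : Dec (e K ≤ e left) → Dec (h K ≤ e left) → ⊥
    by-position (yes eK≤eA) _ = nothing-between left left-interval
      (h<⇒⊂ (subst (_< h K) (sym h-left) hI<hK) eK≤eA) (e<⇒⊂ (≤-reflexive (sym h-left)) eA<eI)
    by-position (no _) (no hK≰eA) = nothing-between right right-interval
      (e<⇒⊂ (subst (_≤ h K) adjacent (≰⇒> hK≰eA)) (subst (e K <_) (sym e-right) eK<eI))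
      (h<⇒⊂ (subst (suc (h I) ≤_) adjacent (s≤s (subst (_≤ e left) h-left (proj₂ (h∈ left)))))
            (≤-reflexive e-right))
    -- K straddles the junction, so K ∪ left = [ h I ⋯ e K ] lies strictly between K and I
    by-position (no eK≰eA) (yes hK≤eA) = nothing-between [ h I ⋯ e K ]
      (∪-interval left-interval K-int (e∈ left) (hK≤eA , eA≤eK) L-rep)
      (h<⇒⊂ hI<hK (≤-reflexive (sym (e-⋯ hI≤eK)))) (e<⇒⊂ ≤-refl (subst (_< e I) (sym (e-⋯ hI≤eK)) eK<eI))
      where
      eA≤eK = <⇒≤ (≰⇒> eK≰eA)
      hI≤eK = ≤-trans (<⇒≤ hI<hK) (proj₂ (h∈ K))
      L-rep : [ h I ⋯ e K ] Represents (λ v → v ∈Seg left ⊎ v ∈Seg K)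
      L-rep = ⋯-represents hI≤eK λ v → mk⇔
        (λ (hI≤v , v≤eK) → case v ≤? e left of λ where
           (yes v≤eA) → inj₁ (subst (_≤ v) (sym h-left) hI≤v , v≤eA)
           (no v≰eA) → inj₂ (≤-trans hK≤eA (<⇒≤ (≰⇒> v≰eA)) , v≤eK))
        [ (λ (hA≤v , v≤eA) → subst (_≤ v) h-left hA≤v , ≤-trans v≤eA eA≤eK)
        , (λ (hK≤v , v≤eK) → ≤-trans (<⇒≤ hI<hK) hK≤v , v≤eK) ]′

  split⇒covers-share-endpoint : ∀ {I K} → Split I → Covers w I K → h K ≡ h I ⊎ e K ≡ e I
  split⇒covers-share-endpoint {I} {K} s c with h K ≟ h I | e K ≟ e I
  ... | yes hK≡hI | _ = inj₁ hK≡hI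
  ... | no _ | yes eK≡eI = inj₂ eK≡eI
  ... | no hK≢hI | no eK≢eI = ⊥-elim (split⇒no-inner-cover s c
        (≤∧≢⇒< (proj₁ (to ⊆⇔ (covers⇒⊆ c))) (hK≢hI ∘ sym))
        (≤∧≢⇒< (proj₂ (to ⊆⇔ (covers⇒⊆ c))) eK≢eI))

  split⇒≤2covers : ∀ {I k} → Split I → (H : Fin k → Seg) → Injective _≡_ _≡_ H →
    (∀ i → Covers w I (H i)) → k ≤ 2
  split⇒≤2covers {I} s H H-inj covers = ≮⇒≥ λ 2<k →
    let (i , i′ , i<i′ , same) = pigeonhole 2<k (side ∘ shares) in
    <⇒≢ᶠ i<i′ (H-inj (same-side (shares i) (shares i′) same))
    where
    Shares : Seg → Set
    Shares K = h K ≡ h I ⊎ e K ≡ e I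
    shares : ∀ i → Shares (H i)
    shares i = split⇒covers-share-endpoint s (covers i)
    side : ∀ {K} → Shares K → Fin 2
    side = [ const 0F , const (sucF 0F) ]′
    same-side : ∀ {i i′} (p : Shares (H i)) (p′ : Shares (H i′)) → side p ≡ side p′ → H i ≡ H i′
    same-side (inj₁ hHi≡hI) (inj₁ hHi′≡hI) _ =
      covered-h≡⇒≡ (covers _) (covers _) (trans hHi≡hI (sym hHi′≡hI))
    same-side (inj₂ eHi≡eI) (inj₂ eHi′≡eI) _ =
      covered-e≡⇒≡ (covers _) (covers _) (trans eHi≡eI (sym eHi′≡eI))
    same-side (inj₁ _) (inj₂ _) ()
    same-side (inj₂ _) (inj₁ _) ()

lemma3p9 : ∀ {n : ℕ} (w : Perm n) (I : Seg) (k : ℕ) (H : Fin k → Seg) →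
    4 ≤ k → IsInterval w I → Injective _≡_ _≡_ H →
    (∀ a → Covers w I (H a)) →
    (∀ G → Covers w I G → ∃ λ a → G ≡ H a) →
    ∀ (a : Fin k) (J : Seg) → Covers w J (H a) → J ≡ I
lemma3p9 (f , f-inj) I k H 4≤k I-int H-inj covers _ a J J-covers with J ⊆? I | I ⊆? J
... | yes J⊆I | _ = covering-⊆⇒≡ f f-inj (covers a) J-covers J⊆I
... | no _ | yes I⊆J = sym (covering-⊆⇒≡ f f-inj J-covers (covers a) I⊆J)
... | no J⊈I | no I⊈J = ⊥-elim (≤⇒≯ k≤2 (≤-trans (n≤1+n 3) 4≤k))
  where
  split = overlap⇒split f f-inj I-int (proj₁ J-covers)
    (covers⇒⊆ f f-inj (covers a) _ (h∈ (H a))) (covers⇒⊆ f f-inj J-covers _ (h∈ (H a))) J⊈I I⊈J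
  k≤2 = split⇒≤2covers f f-inj split H H-inj covers
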